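{- Let $k\ge1$ and let $f:\mathcal{PC}_{2k+2}\to\mathcal{PC}_{2k}$ be a graph homomorphism. If $|f^{ -1}(x)|\ge 5$ for some vertex $x$ of $\mathcal{PC}_{2k}$, then there is a vertex $a$ of $\mathcal{PC}_{2k+2}$ such that $f^{ -1}(x)\subseteq N(a)$.
   Context: The projective cube of dimension $d$, $\mathcal{PC}_d$, is the Cayley graph on $\mathbb{Z}_2^d$ with $u\sim v$ iff $u-v\in\{e_1,\dots,e_d,J\}$, where $e_1,\dots,e_d$ is the canonical basis and $J$ the all-ones vector. $N(a)$ denotes the set of neighbors of $a$. A homomorphism is a map of vertex sets sending edges to edges. -}

module Defs where

open import Data.Nat using (ℕ; suc; _+_; _*_)
open import Data.Bool using (Bool; not)
open import Data.Fin using (Fin)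
open import Data.Vec using (Vec; map; updateAt)
open import Data.Product using (∃-syntax; Σ)
open import Data.Sum using (_⊎_)
open import Relation.Binary.PropositionalEquality using (_≡_)
open import Function.Definitions using (Injective)

-- Vertices of PC_d: elements of Z_2^d, encoded as Boolean vectors (xor = addition).
Vertex : ℕ → Set
Vertex d = Vec Bool d

-- u - v ∈ {e_1,…,e_d, J}: v is u with one coordinate flipped, or u with all flipped.
Adj : {d : ℕ} → Vertex d → Vertex d → Set
Adj {d} u v = (∃[ i ] v ≡ updateAt u i not) ⊎ (v ≡ map not u)

IsHom : {m n : ℕ} → (Vertex m → Vertex n) → Set
IsHom {m} f = ∀ (u v : Vertex m) → Adj u v → Adj (f u) (f v)

PreimageAtLeast5 : {m n : ℕ} → (Vertex m → Vertex n) → Vertex n → Set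
PreimageAtLeast5 {m} f x =
  Σ (Fin 5 → Vertex m) λ g → Injective _≡_ _≡_ g × (∀ i → f (g i) ≡ x)
  where open import Data.Product using (_×_)

PreimageInNbhd : {m n : ℕ} → (Vertex m → Vertex n) → Vertex n → Vertex m → Set
PreimageInNbhd f x a = ∀ u → f u ≡ x → Adj a u

-- If three vectors of a hypercube are pairwise at distance 2,
--    every vector at distance 2 from all three is either at distance 1 from their
--    coordinatewise majority ("near") or is one specific "opposite" vector, which
--    is at distance 4 from every near vector.  Consequently a family of vectors
--    pairwise at distance 2 with at least five members lies in the unit sphere
--    around a single vector (`pairwise-two-star`).
--  * Odd girth.  A walk of length L in PC_n between vertices at Hamming distance
--    w satisfies L ≥ w and L ≡ w (mod 2), or L ≥ n+1-w and L ≡ n+1-w (mod 2);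
--    so closed walks are even or have length at least n+1.  Since u and v are
--    joined by walks of lengths dist u v and 1 + (d - dist u v), a homomorphism
--    PC_{2k+2} → PC_{2k} only identifies vertices at distance 0, 2 or 2k+1
--    (`fibre-distances`).
--  * Double cover.  PC_d is the quotient of the cube Q_{d+1} by the antipodal
--    map.  Lifting a fibre to Q_{d+1}, with the sheet of each vertex chosen
--    relative to a base point, makes its points pairwise at distance exactly 2.
--
-- The theorem applies the star lemma to the lifted fibre and projects the centre.

module Submission where

open import Defs
open import Data.Bool using (Bool; true; false; not; _xor_; _∧_)
open import Data.Bool.Properties using (not-involutive; xor-comm) renaming (_≟_ to _≟ᵇ_)
open import Data.Nat using (ℕ; zero; suc; pred; _+_; _*_; _≥_; _≤_; z≤n; s≤s; _%_)
open import Data.Nat.Properties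
  using (_≟_; +-suc; +-comm; +-identityʳ; +-cancelˡ-≡; +-cancelʳ-≡; +-mono-≤; +-monoʳ-≤;
         +-cancelʳ-≤; ≤-antisym; suc-injective; *-distribˡ-+; *-suc; *-cancelˡ-≡; *-cancelʳ-≡;
         m+n≡0⇒m≡0; even≢odd; +-*-semiring)
open import Data.Nat.DivMod using (m*n%n≡0)
open import Data.Nat.Tactic.RingSolver using (solve-∀)
open import Data.Fin using (Fin; zero; suc)
open import Data.Vec using (Vec; []; _∷_; map; updateAt; lookup; tabulate)
open import Data.Vec.Properties
  using (≡-dec; ∷-injectiveʳ; map-∘; map-cong; map-id; map-updateAt; lookup∘tabulate;
         tabulate∘lookup; tabulate-cong)
open import Data.Product using (∃-syntax; _×_; _,_; proj₁; proj₂)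
open import Data.Sum using (_⊎_; inj₁; inj₂; swap) renaming (map to map-⊎)
open import Relation.Nullary using (Dec; yes; no; contradiction)
open import Relation.Nullary.Decidable using (isYes)
open import Relation.Binary.PropositionalEquality
  using (_≡_; _≢_; refl; sym; trans; cong; cong₂; subst; module ≡-Reasoning)
open import Function using (_∘_; id)
open import Function.Definitions using (Injective)
open import Algebra.Properties.Semiring.Sum +-*-semiring
  using (sum; sum-cong-≗; ∑-distrib-+; *-distribˡ-sum; *-distribʳ-sum; sum-replicate-zero)

open ≡-Reasoning

sum-+ : ∀ {m} (f g : Fin m → ℕ) → sum (λ j → f j + g j) ≡ sum f + sum g
sum-+ = ∑-distrib-+

sum-*ˡ : ∀ {m} c (f : Fin m → ℕ) → sum (λ j → c * f j) ≡ c * sum f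
sum-*ˡ c f = sym (*-distribˡ-sum c f)

sum-*ʳ : ∀ {m} (f : Fin m → ℕ) c → sum (λ j → f j * c) ≡ sum f * c
sum-*ʳ f c = sym (*-distribʳ-sum c f)

sum-mono-≤ : ∀ {m} {f g : Fin m → ℕ} → (∀ j → f j ≤ g j) → sum f ≤ sum g
sum-mono-≤ {zero}  _   = z≤n
sum-mono-≤ {suc m} f≤g = +-mono-≤ (f≤g zero) (sum-mono-≤ (f≤g ∘ suc))

-- Equality case of monotonicity: a pointwise inequality with equal sums is an
-- equality.  This is how a distance count pins down individual coordinates.
sum-mono-≡ : ∀ {m} {f g : Fin m → ℕ} → (∀ j → f j ≤ g j) → sum f ≡ sum g → ∀ j → f j ≡ g j
sum-mono-≡ {suc m} {f} {g} f≤g Σf≡Σg = pointwise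
  where
  tails : sum (f ∘ suc) ≤ sum (g ∘ suc)
  tails = sum-mono-≤ (f≤g ∘ suc)

  -- g₀ + Σg' = f₀ + Σf' ≤ f₀ + Σg', so g₀ ≤ f₀.
  g₀≤f₀ : g zero ≤ f zero
  g₀≤f₀ = +-cancelʳ-≤ (sum (g ∘ suc)) (g zero) (f zero)
            (subst (_≤ f zero + sum (g ∘ suc)) Σf≡Σg (+-monoʳ-≤ (f zero) tails))

  heads : f zero ≡ g zero
  heads = ≤-antisym (f≤g zero) g₀≤f₀

  pointwise : ∀ j → f j ≡ g j
  pointwise zero    = heads
  pointwise (suc j) =
    sum-mono-≡ (f≤g ∘ suc) (+-cancelˡ-≡ (f zero) _ _ (trans Σf≡Σg (cong (_+ _) (sym heads)))) j

sum-zero : ∀ {m} (f : Fin m → ℕ) → sum f ≡ 0 → ∀ j → f j ≡ 0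
sum-zero {m} f Σf≡0 j = sym (sum-mono-≡ (λ _ → z≤n) (trans (sum-replicate-zero m) (sym Σf≡0)) j)

bit : Bool → ℕ
bit true  = 1
bit false = 0

differs : ∀ {m} → Vec Bool m → Vec Bool m → Fin m → ℕ
differs x y j = bit (lookup x j xor lookup y j)

-- Number of coordinates in which x and y differ.
-- It unfolds as  dist (a ∷ x) (b ∷ y) = bit (a xor b) + dist x y.
dist : ∀ {m} → Vec Bool m → Vec Bool m → ℕ
dist x y = sum (differs x y)

dist-refl : ∀ {m} (x : Vec Bool m) → dist x x ≡ 0
dist-refl []          = refl
dist-refl (true ∷ x)  = dist-refl x
dist-refl (false ∷ x) = dist-refl x

dist-sym : ∀ {m} (x y : Vec Bool m) → dist x y ≡ dist y x
dist-sym x y = sum-cong-≗ (λ j → cong bit (xor-comm (lookup x j) (lookup y j)))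

dist-zero : ∀ {m} (x y : Vec Bool m) → dist x y ≡ 0 → x ≡ y
dist-zero []          []          _ = refl
dist-zero (true ∷ x)  (true ∷ y)  e = cong (true ∷_) (dist-zero x y e)
dist-zero (false ∷ x) (false ∷ y) e = cong (false ∷_) (dist-zero x y e)

dist-one : ∀ {m} (x y : Vec Bool m) → dist x y ≡ 1 → ∃[ i ] y ≡ updateAt x i not
dist-one (true ∷ x)  (true ∷ y)  e with dist-one x y e
... | i , y≡x′ = suc i , cong (true ∷_) y≡x′
dist-one (false ∷ x) (false ∷ y) e with dist-one x y e
... | i , y≡x′ = suc i , cong (false ∷_) y≡x′
dist-one (true ∷ x)  (false ∷ y) e = zero , cong (false ∷_) (sym (dist-zero x y (cong pred e)))
dist-one (false ∷ x) (true ∷ y)  e = zero , cong (true ∷_) (sym (dist-zero x y (cong pred e)))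

dist-flip : ∀ {n} (u w : Vec Bool n) i →
  dist (updateAt u i not) w ≡ suc (dist u w) ⊎ dist u w ≡ suc (dist (updateAt u i not) w)
dist-flip (true ∷ u)  (true ∷ w)  zero    = inj₁ refl
dist-flip (true ∷ u)  (false ∷ w) zero    = inj₂ refl
dist-flip (false ∷ u) (true ∷ w)  zero    = inj₂ refl
dist-flip (false ∷ u) (false ∷ w) zero    = inj₁ refl
dist-flip (a ∷ u)     (b ∷ w)     (suc i) = map-⊎ shift shift (dist-flip u w i)
  where
  shift : ∀ {p q} → p ≡ suc q → bit (a xor b) + p ≡ suc (bit (a xor b) + q)
  shift {q = q} e = trans (cong (bit (a xor b) +_) e) (+-suc _ q)

dist-complement : ∀ {n} (u w : Vec Bool n) → dist (map not u) w + dist u w ≡ n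
dist-complement []          []          = refl
dist-complement (true ∷ u)  (true ∷ w)  = cong suc (dist-complement u w)
dist-complement (true ∷ u)  (false ∷ w) = trans (+-suc _ _) (cong suc (dist-complement u w))
dist-complement (false ∷ u) (true ∷ w)  = trans (+-suc _ _) (cong suc (dist-complement u w))
dist-complement (false ∷ u) (false ∷ w) = cong suc (dist-complement u w)

dist-complementʳ : ∀ {n} (u w : Vec Bool n) → dist u (map not w) + dist u w ≡ n
dist-complementʳ u w =
  trans (cong₂ _+_ (dist-sym u (map not w)) (dist-sym u w)) (dist-complement w u)

dist-complement-both : ∀ {n} (u w : Vec Bool n) → dist (map not u) (map not w) ≡ dist u w
dist-complement-both []          []          = refl
dist-complement-both (true ∷ u)  (true ∷ w)  = dist-complement-both u w
dist-complement-both (true ∷ u)  (false ∷ w) = cong suc (dist-complement-both u w)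
dist-complement-both (false ∷ u) (true ∷ w)  = cong suc (dist-complement-both u w)
dist-complement-both (false ∷ u) (false ∷ w) = dist-complement-both u w

complement-involutive : ∀ {n} (u : Vec Bool n) → map not (map not u) ≡ u
complement-involutive u = trans (sym (map-∘ not not u)) (trans (map-cong not-involutive u) (map-id u))

dist-parity : ∀ {m} (X Y Z : Vec Bool m) → ∃[ c ] dist X Y + dist X Z ≡ dist Y Z + 2 * c
dist-parity {m} X Y Z = sum (bit ∘ both) , (begin
  dist X Y + dist X Z
    ≡⟨ sum-+ (differs X Y) (differs X Z) ⟨
  sum (λ j → differs X Y j + differs X Z j)
    ≡⟨ sum-cong-≗ (λ j → bitwise (lookup X j) (lookup Y j) (lookup Z j)) ⟩
  sum (λ j → differs Y Z j + 2 * bit (both j))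
    ≡⟨ sum-+ (differs Y Z) (λ j → 2 * bit (both j)) ⟩
  dist Y Z + sum (λ j → 2 * bit (both j))
    ≡⟨ cong (dist Y Z +_) (sum-*ˡ 2 (bit ∘ both)) ⟩
  dist Y Z + 2 * sum (bit ∘ both) ∎)
  where
  both : Fin m → Bool
  both j = (lookup X j xor lookup Y j) ∧ (lookup X j xor lookup Z j)

  bitwise : ∀ x y z → bit (x xor y) + bit (x xor z) ≡ bit (y xor z) + 2 * bit ((x xor y) ∧ (x xor z))
  bitwise true  true  true  = refl
  bitwise true  true  false = refl
  bitwise true  false true  = refl
  bitwise true  false false = refl
  bitwise false true  true  = refl
  bitwise false true  false = refl
  bitwise false false true  = refl
  bitwise false false false = refl

even-sides : ∀ {m} (X Y Z : Vec Bool m) {a b} n →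
  dist X Y ≡ 2 * a → dist X Z ≡ 2 * b → dist Y Z ≢ suc (2 * n)
even-sides X Y Z {a} {b} n XY XZ YZ with dist-parity X Y Z
... | c , parity = even≢odd (a + b) (n + c) (begin
  2 * (a + b)          ≡⟨ *-distribˡ-+ 2 a b ⟩
  2 * a + 2 * b        ≡⟨ cong₂ _+_ XY XZ ⟨
  dist X Y + dist X Z  ≡⟨ parity ⟩
  dist Y Z + 2 * c     ≡⟨ cong (_+ 2 * c) YZ ⟩
  suc (2 * n) + 2 * c  ≡⟨ cong suc (sym (*-distribˡ-+ 2 n c)) ⟩
  suc (2 * (n + c))    ∎)

majority : Bool → Bool → Bool → Bool
majority true  true  _ = true
majority false false _ = false
majority true  false c = c
majority false true  c = c

split : Bool → Bool → Bool → Bool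
split true  true  true  = false
split false false false = false
split _     _     _     = true

deviation-count : ∀ v a b c → let M = majority a b c ; s = split a b c in
  bit (v xor a) + bit (v xor b) + bit (v xor c) + bit ((v xor M) ∧ s) * 2 ≡ bit s + bit (v xor M) * 3
deviation-count true  true  true  true  = refl
deviation-count true  true  true  false = refl
deviation-count true  true  false true  = refl
deviation-count true  true  false false = refl
deviation-count true  false true  true  = refl
deviation-count true  false true  false = refl
deviation-count true  false false true  = refl
deviation-count true  false false false = refl
deviation-count false true  true  true  = refl
deviation-count false true  true  false = refl
deviation-count false true  false true  = refl
deviation-count false true  false false = refl
deviation-count false false true  true  = refl
deviation-count false false true  false = refl
deviation-count false false false true  = refl
deviation-count false false false false = refl

perimeter-count : ∀ a b c → bit (a xor b) + bit (b xor c) + bit (a xor c) ≡ bit (split a b c) * 2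
perimeter-count true  true  true  = refl
perimeter-count true  true  false = refl
perimeter-count true  false true  = refl
perimeter-count true  false false = refl
perimeter-count false true  true  = refl
perimeter-count false true  false = refl
perimeter-count false false true  = refl
perimeter-count false false false = refl

bit-∧-≤ˡ : ∀ x y → bit (x ∧ y) ≤ bit x
bit-∧-≤ˡ true  true  = s≤s z≤n
bit-∧-≤ˡ true  false = z≤n
bit-∧-≤ˡ false _     = z≤n

bit-∧-≤ʳ : ∀ x y → bit (x ∧ y) ≤ bit y
bit-∧-≤ʳ true  true  = s≤s z≤n
bit-∧-≤ʳ true  false = z≤n
bit-∧-≤ʳ false _     = z≤n

∧-balanced : ∀ x y → bit (x ∧ y) ≡ bit x → bit (x ∧ y) ≡ bit y → x ≡ y
∧-balanced true  true  _ _ = refl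
∧-balanced false false _ _ = refl
∧-balanced true  false () _
∧-balanced false true  _ ()

xor-solve : ∀ x y z → x xor y ≡ z → x ≡ y xor z
xor-solve true  true  _ refl = refl
xor-solve true  false _ refl = refl
xor-solve false true  _ refl = refl
xor-solve false false _ refl = refl

opposite-count : ∀ M s v → bit ((v xor M) ∧ s) ≡ 0 → bit ((M xor s) xor v) ≡ bit s + bit (v xor M)
opposite-count true  true  true  _  = refl
opposite-count true  true  false ()
opposite-count true  false true  _  = refl
opposite-count true  false false _  = refl
opposite-count false true  true  ()
opposite-count false true  false _  = refl
opposite-count false false true  _  = refl
opposite-count false false false _  = refl

-- Arithmetic of the two equations arising below, where N ≤ 3 is an excess and
-- h a distance: only multiples of 3 can equal h * 3.
multiple-of-3 : ∀ h {c} → h * 3 ≡ c → c % 3 ≡ 0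
multiple-of-3 h e = trans (cong (_% 3) (sym e)) (m*n%n≡0 h 3)

equidistant-arith : ∀ N h → N ≤ 3 → 6 + N * 2 ≡ 3 + h * 3 → (h ≡ 1 × N ≡ 0) ⊎ (h ≡ 3 × N ≡ 3)
equidistant-arith 0 h _ e = inj₁ (*-cancelʳ-≡ h 1 3 (sym (+-cancelˡ-≡ 3 _ _ e)) , refl)
equidistant-arith 1 h _ e = contradiction (multiple-of-3 h (sym (+-cancelˡ-≡ 3 _ _ e))) λ ()
equidistant-arith 2 h _ e = contradiction (multiple-of-3 h (sym (+-cancelˡ-≡ 3 _ _ e))) λ ()
equidistant-arith 3 h _ e = inj₂ (*-cancelʳ-≡ h 3 3 (sym (+-cancelˡ-≡ 3 _ _ e)) , refl)
equidistant-arith (suc (suc (suc (suc _)))) _ (s≤s (s≤s (s≤s ()))) _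

corner-arith : ∀ N h → N ≤ 3 → 4 + N * 2 ≡ 3 + h * 3 → h ≡ 1
corner-arith 0 h _ e = contradiction (multiple-of-3 h (sym (+-cancelˡ-≡ 3 _ _ e))) λ ()
corner-arith 1 h _ e = *-cancelʳ-≡ h 1 3 (sym (+-cancelˡ-≡ 3 _ _ e))
corner-arith 2 h _ e = contradiction (multiple-of-3 h (sym (+-cancelˡ-≡ 3 _ _ e))) λ ()
corner-arith 3 h _ e = contradiction (multiple-of-3 h (sym (+-cancelˡ-≡ 3 _ _ e))) λ ()
corner-arith (suc (suc (suc (suc _)))) _ (s≤s (s≤s (s≤s ()))) _

module Triangle {m : ℕ} (W₁ W₂ W₃ : Vec Bool m)
  (d₁₂ : dist W₁ W₂ ≡ 2) (d₂₃ : dist W₂ W₃ ≡ 2) (d₁₃ : dist W₁ W₃ ≡ 2) where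

  split-at : Fin m → Bool
  split-at j = split (lookup W₁ j) (lookup W₂ j) (lookup W₃ j)

  centre : Vec Bool m
  centre = tabulate λ j → majority (lookup W₁ j) (lookup W₂ j) (lookup W₃ j)

  opposite : Vec Bool m
  opposite = tabulate λ j → lookup centre j xor split-at j

  deviates : Vec Bool m → Fin m → Bool
  deviates V j = lookup V j xor lookup centre j

  excess : Vec Bool m → ℕ
  excess V = sum λ j → bit (deviates V j ∧ split-at j)

  -- Number of split coordinates; each contributes 2 to the perimeter, so it is 3.
  spread : ℕ
  spread = sum (bit ∘ split-at)

  spread≡3 : spread ≡ 3
  spread≡3 = *-cancelʳ-≡ spread 3 2 (sym (begin
    6
      ≡⟨ cong₂ _+_ (cong₂ _+_ d₁₂ d₂₃) d₁₃ ⟨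
    dist W₁ W₂ + dist W₂ W₃ + dist W₁ W₃
      ≡⟨ cong (_+ dist W₁ W₃) (sum-+ (differs W₁ W₂) (differs W₂ W₃)) ⟨
    sum (λ j → differs W₁ W₂ j + differs W₂ W₃ j) + dist W₁ W₃
      ≡⟨ sum-+ (λ j → differs W₁ W₂ j + differs W₂ W₃ j) (differs W₁ W₃) ⟨
    sum (λ j → differs W₁ W₂ j + differs W₂ W₃ j + differs W₁ W₃ j)
      ≡⟨ sum-cong-≗ (λ j → perimeter-count (lookup W₁ j) (lookup W₂ j) (lookup W₃ j)) ⟩
    sum (λ j → bit (split-at j) * 2)
      ≡⟨ sum-*ʳ (bit ∘ split-at) 2 ⟩
    spread * 2 ∎))

  excess≤3 : ∀ V → excess V ≤ 3
  excess≤3 V = subst (excess V ≤_) spread≡3 (sum-mono-≤ λ j → bit-∧-≤ʳ (deviates V j) (split-at j))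

  distance-sum : ∀ V →
    dist V W₁ + dist V W₂ + dist V W₃ + excess V * 2 ≡ 3 + dist V centre * 3
  distance-sum V = begin
    dist V W₁ + dist V W₂ + dist V W₃ + excess V * 2
      ≡⟨ cong₂ _+_ (cong (_+ dist V W₃) (sum-+ (differs V W₁) (differs V W₂))) (sum-*ʳ ex 2) ⟨
    sum toV₁₂ + dist V W₃ + sum (λ j → ex j * 2)
      ≡⟨ cong (_+ sum (λ j → ex j * 2)) (sum-+ toV₁₂ (differs V W₃)) ⟨
    sum toV₁₂₃ + sum (λ j → ex j * 2)
      ≡⟨ sum-+ toV₁₂₃ (λ j → ex j * 2) ⟨
    sum (λ j → toV₁₂₃ j + ex j * 2)
      ≡⟨ sum-cong-≗ pointwise ⟩
    sum (λ j → bit (split-at j) + bit (deviates V j) * 3)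
      ≡⟨ sum-+ (bit ∘ split-at) (λ j → bit (deviates V j) * 3) ⟩
    spread + sum (λ j → bit (deviates V j) * 3)
      ≡⟨ cong₂ _+_ spread≡3 (sum-*ʳ (bit ∘ deviates V) 3) ⟩
    3 + dist V centre * 3 ∎
    where
    ex toV₁₂ toV₁₂₃ : Fin m → ℕ
    ex j     = bit (deviates V j ∧ split-at j)
    toV₁₂ j  = differs V W₁ j + differs V W₂ j
    toV₁₂₃ j = toV₁₂ j + differs V W₃ j
    pointwise : ∀ j → toV₁₂₃ j + ex j * 2 ≡ bit (split-at j) + bit (deviates V j) * 3
    pointwise j rewrite lookup∘tabulate (λ i → majority (lookup W₁ i) (lookup W₂ i) (lookup W₃ i)) j =
      deviation-count (lookup V j) (lookup W₁ j) (lookup W₂ j) (lookup W₃ j)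

  distance-sum≡ : ∀ V {s} → dist V W₁ + dist V W₂ + dist V W₃ ≡ s →
    s + excess V * 2 ≡ 3 + dist V centre * 3
  distance-sum≡ V e = trans (cong (_+ excess V * 2) (sym e)) (distance-sum V)

  corner₁ : dist W₁ centre ≡ 1
  corner₁ = corner-arith (excess W₁) _ (excess≤3 W₁)
    (distance-sum≡ W₁ (cong₂ _+_ (cong₂ _+_ (dist-refl W₁) d₁₂) d₁₃))

  corner₂ : dist W₂ centre ≡ 1
  corner₂ = corner-arith (excess W₂) _ (excess≤3 W₂)
    (distance-sum≡ W₂ (cong₂ _+_ (cong₂ _+_ (trans (dist-sym W₂ W₁) d₁₂) (dist-refl W₂)) d₂₃))

  corner₃ : dist W₃ centre ≡ 1
  corner₃ = corner-arith (excess W₃) _ (excess≤3 W₃)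
    (distance-sum≡ W₃ (cong₂ _+_ (cong₂ _+_ (trans (dist-sym W₃ W₁) d₁₃) (trans (dist-sym W₃ W₂) d₂₃)) (dist-refl W₃)))

  Near : Vec Bool m → Set
  Near V = dist V centre ≡ 1 × excess V ≡ 0

  Equidistant : Vec Bool m → Set
  Equidistant V = dist V W₁ ≡ 2 × dist V W₂ ≡ 2 × dist V W₃ ≡ 2

  deviates-on-split : ∀ V → excess V ≡ dist V centre → excess V ≡ spread → V ≡ opposite
  deviates-on-split V ex≡dist ex≡spread =
    trans (sym (tabulate∘lookup V)) (tabulate-cong λ j →
      xor-solve (lookup V j) (lookup centre j) (split-at j)
        (∧-balanced (deviates V j) (split-at j) (on-deviations j) (on-split j)))
    where
    on-deviations : ∀ j → bit (deviates V j ∧ split-at j) ≡ bit (deviates V j)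
    on-deviations = sum-mono-≡ (λ j → bit-∧-≤ˡ (deviates V j) (split-at j)) ex≡dist
    on-split : ∀ j → bit (deviates V j ∧ split-at j) ≡ bit (split-at j)
    on-split = sum-mono-≡ (λ j → bit-∧-≤ʳ (deviates V j) (split-at j)) ex≡spread

  classify : ∀ V → Equidistant V → Near V ⊎ V ≡ opposite
  classify V (e₁ , e₂ , e₃) with equidistant-arith (excess V) (dist V centre) (excess≤3 V)
                                   (distance-sum≡ V (cong₂ _+_ (cong₂ _+_ e₁ e₂) e₃))
  ... | inj₁ (h≡1 , N≡0) = inj₁ (h≡1 , N≡0)
  ... | inj₂ (h≡3 , N≡3) = inj₂ (deviates-on-split V (trans N≡3 (sym h≡3)) (trans N≡3 (sym spread≡3)))

  -- The opposite vector and a near vector deviate from the centre on disjoint sets.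
  opposite-far : ∀ V → Near V → dist opposite V ≡ 4
  opposite-far V (near , no-excess) = begin
    dist opposite V
      ≡⟨ sum-cong-≗ pointwise ⟩
    sum (λ j → bit (split-at j) + bit (deviates V j))
      ≡⟨ sum-+ (bit ∘ split-at) (bit ∘ deviates V) ⟩
    spread + dist V centre
      ≡⟨ cong₂ _+_ spread≡3 near ⟩
    4 ∎
    where
    pointwise : ∀ j → bit (lookup opposite j xor lookup V j) ≡ bit (split-at j) + bit (deviates V j)
    pointwise j rewrite lookup∘tabulate (λ i → lookup centre i xor split-at i) j =
      opposite-count (lookup centre j) (split-at j) (lookup V j)
        (sum-zero (λ i → bit (deviates V i ∧ split-at i)) no-excess j)

  -- Of two equidistant vectors at distance 2 from each other, the first is near:
  -- the opposite vector is at distance 0 from itself and 4 from near vectors.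
  near-of-pair : ∀ V V′ → Equidistant V → Equidistant V′ → dist V V′ ≡ 2 → Near V
  near-of-pair V V′ eqV eqV′ VV′ with classify V eqV
  ... | inj₁ nearV = nearV
  ... | inj₂ refl with classify V′ eqV′
  ...   | inj₁ nearV′ = contradiction (trans (sym (opposite-far V′ nearV′)) VV′) λ ()
  ...   | inj₂ refl   = contradiction (trans (sym (dist-refl opposite)) VV′) λ ()

  near-of-near : ∀ W V → Near W → Equidistant V → dist V W ≡ 2 → dist V centre ≡ 1
  near-of-near W V nearW eqV VW with classify V eqV
  ... | inj₁ nearV = proj₁ nearV
  ... | inj₂ refl  = contradiction (trans (sym (opposite-far W nearW)) VW) λ ()

-- Five distinct vectors pairwise at distance 2 force the whole family onto the
-- unit sphere around one vector: take the centre of the first three; one of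
-- the next two is near it, and then every other member is.
pairwise-two-star : ∀ {m} (Q : Vec Bool m → Set) →
  (∀ {V V′} → Q V → Q V′ → V ≢ V′ → dist V V′ ≡ 2) →
  (W : Fin 5 → Vec Bool m) → Injective _≡_ _≡_ W → (∀ i → Q (W i)) →
  ∃[ A ] (∀ {V} → Q V → dist V A ≡ 1)
pairwise-two-star {m} Q two W W-injective QW = centre , on-sphere
  where
  i₀ i₁ i₂ i₃ i₄ : Fin 5
  i₀ = zero
  i₁ = suc zero
  i₂ = suc (suc zero)
  i₃ = suc (suc (suc zero))
  i₄ = suc (suc (suc (suc zero)))

  distinct : ∀ i j → i ≢ j → W i ≢ W j
  distinct i j i≢j = i≢j ∘ W-injective

  two-apart : ∀ i j → i ≢ j → dist (W i) (W j) ≡ 2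
  two-apart i j i≢j = two (QW i) (QW j) (distinct i j i≢j)

  open Triangle (W i₀) (W i₁) (W i₂) (two-apart i₀ i₁ λ ()) (two-apart i₁ i₂ λ ()) (two-apart i₀ i₂ λ ())

  equidistant : ∀ {V} → Q V → V ≢ W i₀ → V ≢ W i₁ → V ≢ W i₂ → Equidistant V
  equidistant QV V≢W₀ V≢W₁ V≢W₂ = two QV (QW i₀) V≢W₀ , two QV (QW i₁) V≢W₁ , two QV (QW i₂) V≢W₂

  fourth-near : Near (W i₃)
  fourth-near = near-of-pair (W i₃) (W i₄)
    (equidistant (QW i₃) (distinct i₃ i₀ λ ()) (distinct i₃ i₁ λ ()) (distinct i₃ i₂ λ ()))
    (equidistant (QW i₄) (distinct i₄ i₀ λ ()) (distinct i₄ i₁ λ ()) (distinct i₄ i₂ λ ()))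
    (two-apart i₃ i₄ λ ())

  _≟ᵛ_ : (V V′ : Vec Bool m) → Dec (V ≡ V′)
  _≟ᵛ_ = ≡-dec _≟ᵇ_

  on-sphere : ∀ {V} → Q V → dist V centre ≡ 1
  on-sphere {V} QV with V ≟ᵛ W i₀
  ... | yes refl = corner₁
  ... | no V≢W₀ with V ≟ᵛ W i₁
  ...   | yes refl = corner₂
  ...   | no V≢W₁ with V ≟ᵛ W i₂
  ...     | yes refl = corner₃
  ...     | no V≢W₂ with V ≟ᵛ W i₃
  ...       | yes refl = proj₁ fourth-near
  ...       | no V≢W₃ = near-of-near (W i₃) V fourth-near
                          (equidistant QV V≢W₀ V≢W₁ V≢W₂) (two QV (QW i₃) V≢W₃)

data Path {A : Set} (R : A → A → Set) : A → A → ℕ → Set where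
  ε   : ∀ {u} → Path R u u 0
  _◅_ : ∀ {u v w L} → R u v → Path R v w L → Path R u w (suc L)

infixr 5 _◅_

map-path : ∀ {A B : Set} {R : A → A → Set} {S : B → B → Set} (f : A → B) →
  (∀ {u v} → R u v → S (f u) (f v)) → ∀ {u v L} → Path R u v L → Path S (f u) (f v) L
map-path f f-step ε       = ε
map-path f f-step (r ◅ p) = f-step r ◅ map-path f f-step p

Flip : ∀ {n} → Vec Bool n → Vec Bool n → Set
Flip u v = ∃[ i ] v ≡ updateAt u i not

Walk : ∀ {n} → Vertex n → Vertex n → ℕ → Set
Walk = Path Adj

cube-path : ∀ {n} (u v : Vec Bool n) → Path Flip u v (dist u v)
cube-path []      []      = ε
cube-path (a ∷ u) (b ∷ v) = fix-head a b (map-path (b ∷_) extend (cube-path u v))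
  where
  extend : ∀ {c} {x y : Vec Bool _} → Flip x y → Flip (c ∷ x) (c ∷ y)
  extend {c} (i , y≡x′) = suc i , cong (c ∷_) y≡x′

  fix-head : ∀ {w L} a b → Path Flip (b ∷ u) w L → Path Flip (a ∷ u) w (bit (a xor b) + L)
  fix-head true  true  p = p
  fix-head false false p = p
  fix-head true  false p = (zero , refl) ◅ p
  fix-head false true  p = (zero , refl) ◅ p

direct-walk : ∀ {n} (u v : Vertex n) → Walk u v (dist u v)
direct-walk u v = map-path id inj₁ (cube-path u v)

antipodal-walk : ∀ {n} (u v : Vertex n) → Walk u v (suc (dist (map not u) v))
antipodal-walk u v = inj₂ refl ◅ direct-walk (map not u) v

-- A walk of length L between vertices at distance w in PC_n: either L ≥ w with
-- L ≡ w, or L ≥ n+1-w with L ≡ n+1-w (mod 2).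
LengthFits : ℕ → ℕ → ℕ → Set
LengthFits n L w = (∃[ m ] L ≡ w + 2 * m) ⊎ (∃[ m ] L + w ≡ suc n + 2 * m)

fits-flip : ∀ {n L w w′} → LengthFits n L w → w′ ≡ suc w ⊎ w ≡ suc w′ → LengthFits n (suc L) w′
fits-flip (inj₁ (m , refl)) (inj₁ refl) = inj₁ (m , refl)
fits-flip {w′ = w′} (inj₁ (m , refl)) (inj₂ refl) = inj₁ (suc m , shift w′ m)
  where
  shift : ∀ w′ m → suc (suc w′ + 2 * m) ≡ w′ + 2 * suc m
  shift = solve-∀
fits-flip {n} {L} {w} (inj₂ (m , e)) (inj₁ refl) = inj₂ (suc m , (begin
  suc L + suc w             ≡⟨ cong suc (+-suc L w) ⟩
  suc (suc (L + w))         ≡⟨ cong (2 +_) e ⟩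
  suc (suc (suc n + 2 * m)) ≡⟨ shift n m ⟩
  suc n + 2 * suc m         ∎))
  where
  shift : ∀ n m → suc (suc (suc n + 2 * m)) ≡ suc n + 2 * suc m
  shift = solve-∀
fits-flip {L = L} {w′ = w′} (inj₂ (m , e)) (inj₂ refl) = inj₂ (m , trans (sym (+-suc L w′)) e)

fits-complement : ∀ {n L w w′} → w + w′ ≡ n → LengthFits n L w → LengthFits n (suc L) w′
fits-complement {w = w} {w′} refl (inj₁ (m , refl)) = inj₂ (m , shift w w′ m)
  where
  shift : ∀ w w′ m → suc (w + 2 * m) + w′ ≡ suc (w + w′) + 2 * m
  shift = solve-∀
fits-complement {L = L} {w} {w′} refl (inj₂ (m , e)) = inj₁ (suc m , +-cancelʳ-≡ w _ _ (begin
  suc L + w                   ≡⟨ cong suc e ⟩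
  suc (suc (w + w′) + 2 * m)  ≡⟨ shift w w′ m ⟩
  w′ + 2 * suc m + w          ∎))
  where
  shift : ∀ w w′ m → suc (suc (w + w′) + 2 * m) ≡ w′ + 2 * suc m + w
  shift = solve-∀

walk-length-fits : ∀ {n} {u v : Vertex n} {L} → Walk u v L → LengthFits n L (dist u v)
walk-length-fits {u = u} ε = inj₁ (0 , sym (trans (+-identityʳ (dist u u)) (dist-refl u)))
walk-length-fits {n} {u} {v} (inj₁ (i , refl) ◅ p) =
  fits-flip {n} (walk-length-fits p) (swap (dist-flip u v i))
walk-length-fits {n} {u} {v} (inj₂ refl ◅ p) =
  fits-complement {n} (dist-complement u v) (walk-length-fits p)

ClosedLength : ℕ → ℕ → Set
ClosedLength n L = (∃[ m ] L ≡ 2 * m) ⊎ (∃[ m ] L ≡ suc n + 2 * m)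

closed-walk-length : ∀ {n} {u : Vertex n} {L} → Walk u u L → ClosedLength n L
closed-walk-length {n} {u} {L} p with subst (LengthFits n L) (dist-refl u) (walk-length-fits p)
... | inj₁ even = inj₁ even
... | inj₂ (m , e) = inj₂ (m , trans (sym (+-identityʳ L)) e)

map-walk : ∀ {m n} (f : Vertex m → Vertex n) → IsHom f →
  ∀ {u v L} → Walk u v L → Walk (f u) (f v) L
map-walk f hom = map-path f (λ {u} {v} → hom u v)

-- If a homomorphism identifies u and v, the images of the two walks joining
-- them are closed.
identified-closed-lengths : ∀ {m n} (f : Vertex m → Vertex n) → IsHom f → ∀ u v → f u ≡ f v →
  ClosedLength n (dist u v) × ClosedLength n (suc (dist (map not u) v))
identified-closed-lengths {n = n} f hom u v fu≡fv = closed (direct-walk u v) , closed (antipodal-walk u v)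
  where
  closed : ∀ {L} → Walk u v L → ClosedLength n L
  closed {L} p = closed-walk-length {n} (subst (λ y → Walk (f u) y L) (sym fu≡fv) (map-walk f hom p))

-- The two walk lengths add up to 2k+3, so exactly one is odd, hence at least
-- 2k+1; the other is then even and at most 2.
fibre-arith : ∀ k w w′ → w + w′ ≡ 2 * k + 2 →
  ClosedLength (2 * k) w → ClosedLength (2 * k) (suc w′) → w ≡ 0 ⊎ w ≡ 2 ⊎ w ≡ suc (2 * k)
-- both even: their sum 2k+3 would be even
fibre-arith k w w′ e (inj₁ (p , refl)) (inj₁ (q , e′)) = contradiction (begin
  2 * (p + q)       ≡⟨ *-distribˡ-+ 2 p q ⟩
  2 * p + 2 * q     ≡⟨ cong (2 * p +_) e′ ⟨
  2 * p + suc w′    ≡⟨ +-suc (2 * p) w′ ⟩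
  suc (2 * p + w′)  ≡⟨ cong suc e ⟩
  suc (2 * k + 2)   ≡⟨ cong suc (*-distribˡ-+ 2 k 1) ⟨
  suc (2 * (k + 1)) ∎) (even≢odd (p + q) (k + 1))
-- w = 2p even: then p + q = 1
fibre-arith k w w′ e (inj₁ (p , refl)) (inj₂ (q , e′)) = small p q (*-cancelˡ-≡ (p + q) 1 2 (begin
  2 * (p + q)   ≡⟨ *-distribˡ-+ 2 p q ⟩
  2 * p + 2 * q ≡⟨ +-cancelˡ-≡ (2 * k) _ _ (trans (shift k p q) (trans (cong (2 * p +_) (sym w′≡)) e)) ⟩
  2             ∎))
  where
  w′≡ : w′ ≡ 2 * k + 2 * q
  w′≡ = suc-injective e′
  shift : ∀ k p q → 2 * k + (2 * p + 2 * q) ≡ 2 * p + (2 * k + 2 * q)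
  shift = solve-∀
  small : ∀ p q → p + q ≡ 1 → 2 * p ≡ 0 ⊎ 2 * p ≡ 2 ⊎ 2 * p ≡ suc (2 * k)
  small zero          _ _ = inj₁ refl
  small (suc zero)    _ _ = inj₂ (inj₁ refl)
  small (suc (suc p)) _ ()
-- w = 2k+1+2p odd and 1 + w′ = 2q even and positive: then p = 0
fibre-arith k w w′ e (inj₂ (p , refl)) (inj₁ (zero , ()))
fibre-arith k w w′ e (inj₂ (p , refl)) (inj₁ (suc q , e′)) =
  inj₂ (inj₂ (trans (cong (λ z → suc (2 * k) + 2 * z) p≡0) (+-identityʳ _)))
  where
  w′≡ : w′ ≡ suc (2 * q)
  w′≡ = suc-injective (trans e′ (*-suc 2 q))
  shift : ∀ k p q → suc (2 * k) + 2 * p + suc (2 * q) ≡ (2 * k + 2) + 2 * (p + q)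
  shift = solve-∀
  p≡0 : p ≡ 0
  p≡0 = m+n≡0⇒m≡0 p (m+n≡0⇒m≡0 (p + q) (+-cancelˡ-≡ (2 * k + 2) _ 0
          (trans (sym (shift k p q)) (trans (cong (suc (2 * k) + 2 * p +_) (sym w′≡)) (trans e (sym (+-identityʳ _)))))))
-- both odd: their sum 2k+3 would be even
fibre-arith k w w′ e (inj₂ (p , refl)) (inj₂ (q , e′)) = contradiction (+-cancelˡ-≡ (2 * k) _ _ (begin
  2 * k + 2 * 1                         ≡⟨ e ⟨
  suc (2 * k) + 2 * p + w′              ≡⟨ cong (suc (2 * k) + 2 * p +_) w′≡ ⟩
  suc (2 * k) + 2 * p + (2 * k + 2 * q) ≡⟨ shift k p q ⟩
  2 * k + suc (2 * (k + p + q))         ∎)) (even≢odd 1 (k + p + q))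
  where
  w′≡ : w′ ≡ 2 * k + 2 * q
  w′≡ = suc-injective e′
  shift : ∀ k p q → suc (2 * k) + 2 * p + (2 * k + 2 * q) ≡ 2 * k + suc (2 * (k + p + q))
  shift = solve-∀

fibre-distances : ∀ k (f : Vertex (2 * k + 2) → Vertex (2 * k)) → IsHom f → ∀ u v → f u ≡ f v →
  dist u v ≡ 0 ⊎ dist u v ≡ 2 ⊎ dist u v ≡ suc (2 * k)
fibre-distances k f hom u v fu≡fv with identified-closed-lengths f hom u v fu≡fv
... | direct , antipodal =
  fibre-arith k (dist u v) (dist (map not u) v) (trans (+-comm (dist u v) _) (dist-complement u v)) direct antipodal

-- PC_d is the quotient of the cube Q_{d+1} by the antipodal map: the two lifts
-- of u are (0, u) and (1, ū), and projection identifies them.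
lift : ∀ {d} → Bool → Vertex d → Vec Bool (suc d)
lift false u = false ∷ u
lift true  u = true ∷ map not u

project : ∀ {d} → Vec Bool (suc d) → Vertex d
project (false ∷ a) = a
project (true ∷ a)  = map not a

dist-lift : ∀ {d} b b′ (u v : Vertex d) →
  dist (lift b u) (lift b′ v) ≡ dist u v ⊎ dist (lift b u) (lift b′ v) + dist u v ≡ suc d
dist-lift false false u v = inj₁ refl
dist-lift true  true  u v = inj₁ (dist-complement-both u v)
dist-lift false true  u v = inj₂ (cong suc (dist-complementʳ u v))
dist-lift true  false u v = inj₂ (cong suc (dist-complement u v))

lift-injective : ∀ {d b b′} {u v : Vertex d} → lift b u ≡ lift b′ v → u ≡ v
lift-injective {b = false} {false} e = ∷-injectiveʳ e
lift-injective {b = true}  {true} {u} {v} e = begin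
  u                   ≡⟨ complement-involutive u ⟨
  map not (map not u) ≡⟨ cong (map not) (∷-injectiveʳ e) ⟩
  map not (map not v) ≡⟨ complement-involutive v ⟩
  v                   ∎
lift-injective {b = false} {true}  ()
lift-injective {b = true}  {false} ()

adjacent-project : ∀ {d} (A : Vec Bool (suc d)) b (u : Vertex d) → dist (lift b u) A ≡ 1 →
  Adj (project A) u
adjacent-project (false ∷ a) false u e = inj₁ (dist-one a u (trans (dist-sym a u) e))
adjacent-project (true ∷ a)  false u e =
  inj₂ (trans (dist-zero u a (cong pred e)) (sym (complement-involutive a)))
adjacent-project (false ∷ a) true  u e =
  inj₂ (trans (sym (complement-involutive u)) (cong (map not) (dist-zero (map not u) a (cong pred e))))
adjacent-project (true ∷ a)  true  u e with dist-one a (map not u) (trans (dist-sym a (map not u)) e)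
... | i , ū≡a′ = inj₁ (i , (begin
  u                              ≡⟨ complement-involutive u ⟨
  map not (map not u)            ≡⟨ cong (map not) ū≡a′ ⟩
  map not (updateAt a i not)     ≡⟨ map-updateAt a i refl ⟩
  updateAt (map not a) i not     ∎))

-- Lift a fibre of f : PC_{2k+2} → PC_{2k} relative to a base point u₀: the
-- vertices at distance 2k+1 from u₀ go to the other sheet.  Then all lifted
-- points are at even distance from the lift of u₀, hence pairwise at distance 2.
module LiftedFibre {k} (f : Vertex (2 * k + 2) → Vertex (2 * k)) (hom : IsHom f)
  {x : Vertex (2 * k)} {u₀ : Vertex (2 * k + 2)} (fu₀ : f u₀ ≡ x) where

  sheet : Vertex (2 * k + 2) → Bool
  sheet u = isYes (dist u₀ u ≟ suc (2 * k))

  lifted : Vertex (2 * k + 2) → Vec Bool (suc (2 * k + 2))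
  lifted u = lift (sheet u) u

  lifted-base : lifted u₀ ≡ false ∷ u₀
  lifted-base rewrite dist-refl u₀ = refl

  from-base : ∀ u → f u ≡ x → ∃[ c ] dist (lifted u₀) (lifted u) ≡ 2 * c
  from-base u fu rewrite lifted-base with dist u₀ u ≟ suc (2 * k)
  ... | yes antipodal = 1 , cong suc (+-cancelʳ-≡ (suc (2 * k)) _ _ (begin
    dist u₀ (map not u) + suc (2 * k) ≡⟨ cong (dist u₀ (map not u) +_) antipodal ⟨
    dist u₀ (map not u) + dist u₀ u   ≡⟨ dist-complementʳ u₀ u ⟩
    2 * k + 2                         ≡⟨ +-comm (2 * k) 2 ⟩
    1 + suc (2 * k)                   ∎))
  ... | no not-antipodal with fibre-distances k f hom u₀ u (trans fu₀ (sym fu))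
  ...   | inj₁ d≡0           = 0 , d≡0
  ...   | inj₂ (inj₁ d≡2)    = 1 , d≡2
  ...   | inj₂ (inj₂ d≡2k+1) = contradiction d≡2k+1 not-antipodal

  lifted-not-odd : ∀ u v → f u ≡ x → f v ≡ x → dist (lifted u) (lifted v) ≢ suc (2 * k)
  lifted-not-odd u v fu fv with from-base u fu | from-base v fv
  ... | a , du | b , dv = even-sides (lifted u₀) (lifted u) (lifted v) {a} {b} k du dv

  opposite-sheet-2 : ∀ D → D + 2 ≡ suc (2 * k + 2) → D ≡ suc (2 * k)
  opposite-sheet-2 D e = +-cancelʳ-≡ 2 D (suc (2 * k)) (trans e (shift k))
    where
    shift : ∀ k → suc (2 * k + 2) ≡ suc (2 * k) + 2
    shift = solve-∀

  opposite-sheet-2k+1 : ∀ D → D + suc (2 * k) ≡ suc (2 * k + 2) → D ≡ 2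
  opposite-sheet-2k+1 D e = +-cancelʳ-≡ (suc (2 * k)) D 2 (trans e (shift k))
    where
    shift : ∀ k → suc (2 * k + 2) ≡ 2 + suc (2 * k)
    shift = solve-∀

  -- The lifted distance is dist u v ∈ {2, 2k+1} or 2k+3 minus it, and it is not 2k+1.
  lifted-pairwise : ∀ u v → f u ≡ x → f v ≡ x → u ≢ v → dist (lifted u) (lifted v) ≡ 2
  lifted-pairwise u v fu fv u≢v
    with dist-lift (sheet u) (sheet v) u v | fibre-distances k f hom u v (trans fu (sym fv))
  ... | _      | inj₁ d≡0           = contradiction (dist-zero u v d≡0) u≢v
  ... | inj₁ e | inj₂ (inj₁ d≡2)    = trans e d≡2
  ... | inj₁ e | inj₂ (inj₂ d≡2k+1) = contradiction (trans e d≡2k+1) (lifted-not-odd u v fu fv)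
  ... | inj₂ e | inj₂ (inj₁ d≡2)    =
    contradiction (opposite-sheet-2 _ (trans (cong (_+_ (dist (lifted u) (lifted v))) (sym d≡2)) e))
                  (lifted-not-odd u v fu fv)
  ... | inj₂ e | inj₂ (inj₂ d≡2k+1) =
    opposite-sheet-2k+1 _ (trans (cong (_+_ (dist (lifted u) (lifted v))) (sym d≡2k+1)) e)

corollary12 : (k : ℕ) → k ≥ 1 → (f : Vertex (2 * k + 2) → Vertex (2 * k)) → IsHom f →
    (x : Vertex (2 * k)) → PreimageAtLeast5 f x →
    ∃[ a ] PreimageInNbhd f x a
corollary12 k _ f hom x (g , g-injective , g-in-fibre) =
  project A , λ u fu → adjacent-project A (sheet u) u (near (u , fu , refl))
  where
  open LiftedFibre {k} f hom (g-in-fibre zero)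

  InLiftedFibre : Vec Bool (suc (2 * k + 2)) → Set
  InLiftedFibre V = ∃[ u ] f u ≡ x × lifted u ≡ V

  pairwise : ∀ {V V′} → InLiftedFibre V → InLiftedFibre V′ → V ≢ V′ → dist V V′ ≡ 2
  pairwise (u , fu , refl) (v , fv , refl) V≢V′ = lifted-pairwise u v fu fv (V≢V′ ∘ cong lifted)

  star : ∃[ A ] (∀ {V} → InLiftedFibre V → dist V A ≡ 1)
  star = pairwise-two-star InLiftedFibre pairwise (lifted ∘ g) (g-injective ∘ lift-injective)
           (λ i → g i , g-in-fibre i , refl)

  A : Vec Bool (suc (2 * k + 2))
  A = proj₁ star

  near : ∀ {V} → InLiftedFibre V → dist V A ≡ 1
  near = proj₂ star
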